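{- Let $\ell$ be a positive integer. Every graph $G$ with average degree at least $8\ell$ contains a (not necessarily spanning) bipartite subgraph $H$ which is $\ell$-connected.
   Context: All graphs are finite and simple. A graph is $\ell$-connected if one must remove at least $\ell$ vertices in order to disconnect it or to leave only a single vertex. -}

module Defs where

open import Data.Nat using (ℕ; suc; _+_; _*_; _≤_; _<_)
open import Data.Bool using (Bool; true; false)
open import Data.Fin using (Fin)
open import Data.Fin.Subset using (Subset; _∈_; _∉_; ∣_∣)
open import Data.Vec using (tabulate; sum)
open import Data.Empty using (⊥)
open import Data.Product using (_×_; Σ; Σ-syntax)
open import Relation.Binary.PropositionalEquality using (_≡_)

record Graph : Set where
  field
    n      : ℕ
    adj    : Fin n → Fin n → Bool
    sym    : ∀ i j → adj i j ≡ adj j i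
    irrefl : ∀ i → adj i i ≡ false
open Graph public

degree : (G : Graph) → Fin (n G) → ℕ
degree G i = ∣ tabulate (adj G i) ∣

degreeSum : Graph → ℕ
degreeSum G = sum (tabulate (degree G))

-- average degree at least d  (for a nonempty graph):  d * |V| ≤ Σ deg
AvgDegreeAtLeast : Graph → ℕ → Set
AvgDegreeAtLeast G d = d * n G ≤ degreeSum G

record Subgraph (G : Graph) : Set where
  field
    verts      : Subset (n G)
    edges      : Fin (n G) → Fin (n G) → Bool
    edges-sym  : ∀ i j → edges i j ≡ edges j i
    edges-adj  : ∀ i j → edges i j ≡ true → adj G i j ≡ true
    edges-vert : ∀ i j → edges i j ≡ true → (i ∈ verts) × (j ∈ verts)
open Subgraph public

Bipartite : {G : Graph} → Subgraph G → Set
Bipartite {G} H = Σ[ c ∈ (Fin (n G) → Bool) ]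
  (∀ i j → edges H i j ≡ true → (c i ≡ c j → ⊥))

data Walk {G : Graph} (H : Subgraph G) (P : Fin (n G) → Set)
     : Fin (n G) → Fin (n G) → Set where
  nil  : ∀ {u} → P u → Walk H P u u
  cons : ∀ {u v w} → P u → edges H u v ≡ true → Walk H P v w → Walk H P u w

Remaining : {G : Graph} → Subgraph G → Subset (n G) → Fin (n G) → Set
Remaining H X w = (w ∈ verts H) × (w ∉ X)

ConnectedAfterRemoving : {G : Graph} → Subgraph G → Subset (n G) → Set
ConnectedAfterRemoving H X =
  ∀ u v → Remaining H X u → Remaining H X v → Walk H (Remaining H X) u v

KConnected : {G : Graph} → ℕ → Subgraph G → Set
KConnected {G} ℓ H =
  (suc ℓ ≤ ∣ verts H ∣) × (∀ (X : Subset (n G)) → ∣ X ∣ < ℓ → ConnectedAfterRemoving H X)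

-- A colouring in which no vertex has more neighbours of its own colour than of the other
-- (reached by local search, since each recolouring enlarges the cut) keeps at least half of
-- every degree on crossing edges, so the bipartite graph B of crossing edges has average
-- degree at least 4ℓ.  Mader's argument then gives an ℓ-connected subgraph of B: call S dense
-- if |S| ≥ 2ℓ − 1 and e(B[S]) > 2ℓ(|S| − ℓ).  The whole vertex set is dense, and a minimal
-- dense S induces an ℓ-connected graph.  Indeed, a vertex of degree at most 2ℓ could be
-- deleted; and if X with |X| < ℓ separated B[S] − X, with C a component, then the smaller
-- sets C ∪ (S ∩ X) and S ∖ C cover every edge of B[S] and together have fewer than |S| + ℓ
-- vertices, so one of them would still be dense.

module Submission where

open import Defs hiding (sym)
open import Data.Bool using (Bool; true; false; _∧_; _∨_; not; _xor_)
open import Data.Bool.Properties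
  using (∧-zeroʳ; ∧-identityʳ; ∨-zeroʳ; ∨-identityʳ; xor-comm; xor-identityʳ; xor-same)
  renaming (_≟_ to _≟ᵇ_)
open import Data.Empty using (⊥; ⊥-elim)
open import Data.Fin using (Fin; zero; suc)
open import Data.Fin.Properties using (_≟_; any?)
open import Data.Fin.Subset using (Subset; _∈_; ∣_∣)
open import Data.Fin.Subset.Properties using (anySubset?)
open import Data.Nat
  using (ℕ; zero; suc; _+_; _*_; _∸_; _≤_; _<_; z≤n; s≤s; s≤s⁻¹; _<?_; _≤?_; >-nonZero)
open import Data.Nat.Induction using (<-wellFounded)
open import Data.Nat.Properties hiding (_≟_)
open import Data.Nat.Tactic.RingSolver using (solve-∀)
open import Data.Product using (Σ-syntax; _×_; _,_; proj₁; proj₂)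
open import Data.Sum using (_⊎_; inj₁; inj₂)
open import Data.Vec using ([]; _∷_; lookup; tabulate)
import Data.Vec
open import Data.Vec.Properties using (lookup∘tabulate; lookup⇒[]=; []=⇒lookup)
open import Function using (_∘_; case_of_)
open import Induction.WellFounded using (Acc; acc)
open import Relation.Binary.PropositionalEquality
open import Relation.Nullary using (¬_; Dec; yes; no; does)
open import Relation.Nullary.Decidable using (dec-true; dec-false; _×-dec_)
open import Algebra.Properties.CommutativeMonoid.Sum +-0-commutativeMonoid
  using (sum; sum-cong-≗; ∑-distrib-+; sum-replicate-zero)
open import Algebra.Properties.CommutativeSemigroup +-commutativeSemigroup
  using (xy∙z≈y∙xz; xy∙z≈xz∙y)
open import Algebra.Properties.Semiring.Sum +-*-semiring using (*-distribˡ-sum)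

⟦_⟧ : Bool → ℕ
⟦ true ⟧ = 1
⟦ false ⟧ = 0

⟦⟧≤1 : ∀ b → ⟦ b ⟧ ≤ 1
⟦⟧≤1 true = ≤-refl
⟦⟧≤1 false = z≤n

⟦⟧-mono : ∀ {x y} → (x ≡ true → y ≡ true) → ⟦ x ⟧ ≤ ⟦ y ⟧
⟦⟧-mono {false} _ = z≤n
⟦⟧-mono {true} x⇒y rewrite x⇒y refl = ≤-refl

⟦⟧≤⟦⟧+⟦⟧ : ∀ {x y z} → (x ≡ true → y ≡ true ⊎ z ≡ true) →
  ⟦ x ⟧ ≤ ⟦ y ⟧ + ⟦ z ⟧
⟦⟧≤⟦⟧+⟦⟧ {false} _ = z≤n
⟦⟧≤⟦⟧+⟦⟧ {true} {y} {z} y∨z with y∨z refl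
... | inj₁ refl = s≤s z≤n
... | inj₂ refl = subst (1 ≤_) (+-comm 1 ⟦ y ⟧) (s≤s z≤n)

∧-true⇒ : ∀ x {y} → x ∧ y ≡ true → x ≡ true × y ≡ true
∧-true⇒ true y≡true = refl , y≡true

true∧true : ∀ {x y} → x ≡ true → y ≡ true → x ∧ y ≡ true
true∧true refl refl = refl

true≢false : true ≢ false
true≢false ()

not-true⇒ : ∀ {x} → not x ≡ true → x ≡ false
not-true⇒ {false} refl = refl

_==_ : ∀ {n} → Fin n → Fin n → Bool
i == j = does (i ≟ j)

==-refl : ∀ {n} (i : Fin n) → (i == i) ≡ true
==-refl i = dec-true (i ≟ i) refl

==-≢ : ∀ {n} {i j : Fin n} → i ≢ j → (i == j) ≡ false
==-≢ {i = i} {j} = dec-false (i ≟ j)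

==⇒≡ : ∀ {n} {i j : Fin n} → (i == j) ≡ true → i ≡ j
==⇒≡ {i = i} {j} i==j with i ≟ j
... | yes i≡j = i≡j

sum-mono-≤ : ∀ {n} {f g : Fin n → ℕ} → (∀ i → f i ≤ g i) → sum f ≤ sum g
sum-mono-≤ {zero} f≤g = z≤n
sum-mono-≤ {suc n} f≤g = +-mono-≤ (f≤g zero) (sum-mono-≤ (f≤g ∘ suc))

sum-mono-< : ∀ {n} {f g : Fin n → ℕ} → (∀ i → f i ≤ g i) →
  ∀ v → f v < g v → sum f < sum g
sum-mono-< f≤g zero fv<gv = +-mono-<-≤ fv<gv (sum-mono-≤ (f≤g ∘ suc))
sum-mono-< f≤g (suc v) fv<gv = +-mono-≤-< (f≤g zero) (sum-mono-< (f≤g ∘ suc) v fv<gv)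

sum-zero : ∀ {n} {f : Fin n → ℕ} → (∀ i → f i ≡ 0) → sum f ≡ 0
sum-zero {n} f≡0 = trans (sum-cong-≗ f≡0) (sum-replicate-zero n)

sum-const-1 : ∀ n → sum {n} (λ _ → 1) ≡ n
sum-const-1 zero = refl
sum-const-1 (suc n) = cong suc (sum-const-1 n)

sum-δ : ∀ {n} (v : Fin n) (f : Fin n → ℕ) → sum (λ i → ⟦ i == v ⟧ * f i) ≡ f v
sum-δ {suc n} zero f =
  trans (cong₂ _+_ (*-identityˡ (f zero)) (sum-replicate-zero n)) (+-identityʳ (f zero))
sum-δ {suc n} (suc v) f = sum-δ v (f ∘ suc)

count : ∀ {n} → (Fin n → Bool) → ℕ
count p = sum (⟦_⟧ ∘ p)

count>0⇒∃ : ∀ {n} {p : Fin n → Bool} → 0 < count p → Σ[ i ∈ Fin n ] p i ≡ true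
count>0⇒∃ {p = p} count>0 with any? (λ i → p i ≟ᵇ true)
... | yes found = found
... | no none = ⊥-elim (<⇒≢ count>0 (sym (sum-zero empty)))
  where
  empty : ∀ i → ⟦ p i ⟧ ≡ 0
  empty i with p i in pi
  ... | true = ⊥-elim (none (i , pi))
  ... | false = refl

count-cong : ∀ {n} {p q : Fin n → Bool} → (∀ i → p i ≡ q i) → count p ≡ count q
count-cong p≡q = sum-cong-≗ (cong ⟦_⟧ ∘ p≡q)

count≤n : ∀ {n} (p : Fin n → Bool) → count p ≤ n
count≤n {zero} p = z≤n
count≤n {suc n} p = +-mono-≤ (⟦⟧≤1 (p zero)) (count≤n (p ∘ suc))

count-mono : ∀ {n} {p q : Fin n → Bool} → (∀ i → p i ≡ true → q i ≡ true) →
  count p ≤ count q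
count-mono p⊆q = sum-mono-≤ (⟦⟧-mono ∘ p⊆q)

count-mono-< : ∀ {n} {p q : Fin n → Bool} → (∀ i → p i ≡ true → q i ≡ true) →
  ∀ v → p v ≡ false → q v ≡ true → count p < count q
count-mono-< p⊆q v pv qv =
  sum-mono-< (⟦⟧-mono ∘ p⊆q) v (subst₂ (λ a b → ⟦ a ⟧ < ⟦ b ⟧) (sym pv) (sym qv) ≤-refl)

∣∣≡count : ∀ {n} (X : Subset n) → ∣ X ∣ ≡ count (lookup X)
∣∣≡count [] = refl
∣∣≡count (true ∷ X) = cong suc (∣∣≡count X)
∣∣≡count (false ∷ X) = ∣∣≡count X

∣tabulate∣≡count : ∀ {n} (p : Fin n → Bool) → ∣ tabulate p ∣ ≡ count p
∣tabulate∣≡count p = trans (∣∣≡count (tabulate p)) (count-cong (lookup∘tabulate p))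

∈tabulate : ∀ {n} {p : Fin n → Bool} {i} → p i ≡ true → i ∈ tabulate p
∈tabulate {p = p} {i} pi = lookup⇒[]= i (tabulate p) (trans (lookup∘tabulate p i) pi)

∈tabulate⁻ : ∀ {n} {p : Fin n → Bool} {i} → i ∈ tabulate p → p i ≡ true
∈tabulate⁻ {p = p} {i} i∈p = trans (sym (lookup∘tabulate p i)) ([]=⇒lookup i∈p)

_─_ : ∀ {n} → (Fin n → Bool) → Fin n → Fin n → Bool
(S ─ v) w = S w ∧ not (w == v)

count-─ : ∀ {n} {S : Fin n → Bool} {v : Fin n} → S v ≡ true →
  count S ≡ suc (count (S ─ v))
count-─ {S = S} {v} Sv = begin
  count S                                     ≡⟨ sum-cong-≗ split ⟩
  sum (λ w → ⟦ (S ─ v) w ⟧ + ⟦ w == v ⟧ * 1)  ≡⟨ ∑-distrib-+ (⟦_⟧ ∘ (S ─ v)) _ ⟩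
  count (S ─ v) + sum (λ w → ⟦ w == v ⟧ * 1)  ≡⟨ cong (count (S ─ v) +_) (sum-δ v _) ⟩
  count (S ─ v) + 1                           ≡⟨ +-comm _ 1 ⟩
  suc (count (S ─ v))                         ∎
  where
  open ≡-Reasoning
  split : ∀ w → ⟦ S w ⟧ ≡ ⟦ (S ─ v) w ⟧ + ⟦ w == v ⟧ * 1
  split w with w ≟ v
  ... | yes refl rewrite Sv = refl
  ... | no _ rewrite ∧-identityʳ (S w) = sym (+-identityʳ _)

insert : ∀ {n} → Fin n → (Fin n → Bool) → Fin n → Bool
insert v S w = S w ∨ (w == v)

count-insert : ∀ {n} {S : Fin n → Bool} {v : Fin n} → S v ≡ false →
  count (insert v S) ≡ suc (count S)
count-insert {S = S} {v} Sv =
  trans (count-─ {S = insert v S} inserted) (cong suc (count-cong restored))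
  where
  inserted : insert v S v ≡ true
  inserted = trans (cong (S v ∨_) (==-refl v)) (∨-zeroʳ (S v))
  restored : ∀ w → (insert v S ─ v) w ≡ S w
  restored w with w ≟ v
  ... | yes refl = trans (∧-zeroʳ _) (sym Sv)
  ... | no _ = trans (∧-identityʳ _) (∨-identityʳ (S w))

sum-tabulate : ∀ {n} (f : Fin n → ℕ) → Data.Vec.sum (tabulate f) ≡ sum f
sum-tabulate {zero} f = refl
sum-tabulate {suc n} f = cong (f zero +_) (sum-tabulate (f ∘ suc))

degreeSum≡sum-count : (G : Graph) → degreeSum G ≡ sum (λ v → count (adj G v))
degreeSum≡sum-count G =
  trans (sum-tabulate (degree G)) (sum-cong-≗ (λ v → ∣tabulate∣≡count (adj G v)))

sum² : ∀ {n} → (Fin n → Fin n → ℕ) → ℕ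
sum² f = sum (λ u → sum (f u))

sum²-distrib-+ : ∀ {n} (f g : Fin n → Fin n → ℕ) →
  sum² (λ u w → f u w + g u w) ≡ sum² f + sum² g
sum²-distrib-+ f g =
  trans (sum-cong-≗ (λ u → ∑-distrib-+ (f u) (g u))) (∑-distrib-+ (sum ∘ f) (sum ∘ g))

ends-at : ∀ {n} → Fin n → Fin n → Fin n → ℕ
ends-at v u w = ⟦ u == v ⟧ + ⟦ w == v ⟧

sum²-ends-at : ∀ {n} (v : Fin n) (f : Fin n → Fin n → ℕ) →
  sum² (λ u w → f u w * ends-at v u w) ≡ sum (f v) + sum (λ u → f u v)
sum²-ends-at v f = begin
  sum² (λ u w → f u w * ends-at v u w)
    ≡⟨ sum-cong-≗ (λ u → sum-cong-≗ (λ w → *-distribˡ-+ (f u w) _ _)) ⟩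
  sum² (λ u w → f u w * ⟦ u == v ⟧ + f u w * ⟦ w == v ⟧)
    ≡⟨ sum²-distrib-+ (λ u w → f u w * ⟦ u == v ⟧) (λ u w → f u w * ⟦ w == v ⟧) ⟩
  sum² (λ u w → f u w * ⟦ u == v ⟧) + sum² (λ u w → f u w * ⟦ w == v ⟧)
    ≡⟨ cong₂ _+_ (trans (sum-cong-≗ row) (sum-δ v (sum ∘ f)))
                 (sum-cong-≗ (λ u → trans (sum-cong-≗ (λ w → *-comm (f u w) _))
                                          (sum-δ v (f u)))) ⟩
  sum (f v) + sum (λ u → f u v) ∎
  where
  open ≡-Reasoning
  row : ∀ u → sum (λ w → f u w * ⟦ u == v ⟧) ≡ ⟦ u == v ⟧ * sum (f u)
  row u = trans (sum-cong-≗ (λ w → *-comm (f u w) _)) (sym (*-distribˡ-sum ⟦ u == v ⟧ (f u)))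

-- The total changes by twice the change of row v, with both sides moved to avoid subtraction.
sum²-update : ∀ {n} (v : Fin n) {f g : Fin n → Fin n → ℕ} →
  (∀ u w → f u w ≡ f w u) → (∀ u w → g u w ≡ g w u) →
  (∀ u w → u ≢ v → w ≢ v → f u w ≡ g u w) → f v v ≡ g v v →
  sum² g + (sum (f v) + sum (f v)) ≡ sum² f + (sum (g v) + sum (g v))
sum²-update v {f} {g} f-sym g-sym f≡g-off-v f≡g-at-v = begin
  sum² g + (sum (f v) + sum (f v))
    ≡⟨ cong (λ s → sum² g + (sum (f v) + s)) (sum-cong-≗ (f-sym v)) ⟩
  sum² g + (sum (f v) + sum (λ u → f u v))
    ≡⟨ cong (sum² g +_) (sum²-ends-at v f) ⟨
  sum² g + sum² (λ u w → f u w * ends-at v u w)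
    ≡⟨ sum²-distrib-+ g _ ⟨
  sum² (λ u w → g u w + f u w * ends-at v u w)
    ≡⟨ sum-cong-≗ (λ u → sum-cong-≗ (exchange u)) ⟩
  sum² (λ u w → f u w + g u w * ends-at v u w)
    ≡⟨ sum²-distrib-+ f _ ⟩
  sum² f + sum² (λ u w → g u w * ends-at v u w)
    ≡⟨ cong (sum² f +_) (sum²-ends-at v g) ⟩
  sum² f + (sum (g v) + sum (λ u → g u v))
    ≡⟨ cong (λ s → sum² f + (sum (g v) + s)) (sum-cong-≗ (g-sym v)) ⟨
  sum² f + (sum (g v) + sum (g v)) ∎
  where
  open ≡-Reasoning
  swap : ∀ a b → b + a * 1 ≡ a + b * 1
  swap a b rewrite *-identityʳ a | *-identityʳ b = +-comm b a
  exchange : ∀ u w → g u w + f u w * ends-at v u w ≡ f u w + g u w * ends-at v u w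
  exchange u w with u ≟ v | w ≟ v
  ... | yes refl | yes refl rewrite f≡g-at-v = refl
  ... | yes refl | no _ = swap (f u w) (g u w)
  ... | no _ | yes refl = swap (f u w) (g u w)
  ... | no u≢v | no w≢v =
    subst (λ a → g u w + a * 0 ≡ a + g u w * 0) (sym (f≡g-off-v u w u≢v w≢v)) refl

module _ (G : Graph) where

  Colouring : Set
  Colouring = Fin (n G) → Bool

  crossing : Colouring → Fin (n G) → Fin (n G) → Bool
  crossing c u w = adj G u w ∧ (c u xor c w)

  monochromatic : Colouring → Fin (n G) → Fin (n G) → Bool
  monochromatic c u w = adj G u w ∧ not (c u xor c w)

  crossing-sym : ∀ c u w → crossing c u w ≡ crossing c w u
  crossing-sym c u w = cong₂ _∧_ (Graph.sym G u w) (xor-comm (c u) (c w))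

  crossing-irrefl : ∀ c u → crossing c u u ≡ false
  crossing-irrefl c u = cong (_∧ (c u xor c u)) (irrefl G u)

  degree-split : ∀ c v → count (adj G v) ≡ count (crossing c v) + count (monochromatic c v)
  degree-split c v = trans (sum-cong-≗ (λ w → split (adj G v w) (c v xor c w)))
                           (∑-distrib-+ (⟦_⟧ ∘ crossing c v) (⟦_⟧ ∘ monochromatic c v))
    where
    split : ∀ a x → ⟦ a ⟧ ≡ ⟦ a ∧ x ⟧ + ⟦ a ∧ not x ⟧
    split true true = refl
    split true false = refl
    split false x = refl

  cutSize : Colouring → ℕ
  cutSize c = sum² (λ u w → ⟦ crossing c u w ⟧)

  cutSize≤degreeSum : ∀ c → cutSize c ≤ sum (λ v → count (adj G v))
  cutSize≤degreeSum c =
    sum-mono-≤ (λ v → subst (count (crossing c v) ≤_) (sym (degree-split c v)) (m≤m+n _ _))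

  recolour : Colouring → Fin (n G) → Colouring
  recolour c v u = c u xor (u == v)

  cutSize-recolour : ∀ c v →
    cutSize (recolour c v) + (count (crossing c v) + count (crossing c v)) ≡
    cutSize c + (count (monochromatic c v) + count (monochromatic c v))
  cutSize-recolour c v = trans
    (sum²-update v (λ u w → cong ⟦_⟧ (crossing-sym c u w))
                   (λ u w → cong ⟦_⟧ (crossing-sym c' u w))
                   unchanged
                   (cong ⟦_⟧ (trans (crossing-irrefl c v) (sym (crossing-irrefl c' v)))))
    (cong (λ s → cutSize c + (s + s)) (count-cong flipped))
    where
    c' = recolour c v
    unchanged : ∀ u w → u ≢ v → w ≢ v → ⟦ crossing c u w ⟧ ≡ ⟦ crossing c' u w ⟧
    unchanged u w u≢v w≢v
      rewrite ==-≢ u≢v | ==-≢ w≢v | xor-identityʳ (c u) | xor-identityʳ (c w) = refl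
    flipped : ∀ w → crossing c' v w ≡ monochromatic c v w
    flipped w with w ≟ v
    ... | yes refl rewrite irrefl G w = refl
    ... | no _ rewrite ==-refl v with c v | c w
    ... | true | true = refl
    ... | true | false = refl
    ... | false | true = refl
    ... | false | false = refl

  LocallyMaximal : Colouring → Set
  LocallyMaximal c = ∀ v → count (monochromatic c v) ≤ count (crossing c v)

  recolour-improves : ∀ c v → count (crossing c v) < count (monochromatic c v) →
    cutSize c < cutSize (recolour c v)
  recolour-improves c v x<y = +-cancelʳ-< (x + x) (cutSize c) (cutSize (recolour c v))
    (subst (cutSize c + (x + x) <_) (sym (cutSize-recolour c v))
           (+-monoʳ-< (cutSize c) (+-mono-< x<y x<y)))
    where x = count (crossing c v)

  -- Terminates since each recolouring increases the cut, which is bounded by the degree sum.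
  localSearch : ∀ c → Acc _<_ (sum (λ v → count (adj G v)) ∸ cutSize c) →
    Σ[ c ∈ Colouring ] LocallyMaximal c
  localSearch c (acc rs) with any? (λ v → count (crossing c v) <? count (monochromatic c v))
  ... | no noGain = c , λ v → ≮⇒≥ (λ gain → noGain (v , gain))
  ... | yes (v , gain) = localSearch (recolour c v)
          (rs (∸-monoʳ-< (recolour-improves c v gain) (cutSize≤degreeSum (recolour c v))))

  halvingColouring :
    Σ[ c ∈ Colouring ] ∀ v → count (adj G v) ≤ count (crossing c v) + count (crossing c v)
  halvingColouring with localSearch (λ _ → false) (<-wellFounded _)
  ... | c , maximal = c , λ v → subst (_≤ count (crossing c v) + count (crossing c v))
                                    (sym (degree-split c v)) (+-monoʳ-≤ _ (maximal v))

crossingGraph : (G : Graph) → Colouring G → Graph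
crossingGraph G c = record
  { n      = n G
  ; adj    = crossing G c
  ; sym    = crossing-sym G c
  ; irrefl = crossing-irrefl G c
  }

halvingCrossingGraph : (G : Graph) →
  Σ[ c ∈ Colouring G ] degreeSum G ≤ 2 * degreeSum (crossingGraph G c)
halvingCrossingGraph G with halvingColouring G
... | c , half = c , (begin
  degreeSum G                                 ≡⟨ degreeSum≡sum-count G ⟩
  sum (λ v → count (adj G v))                 ≤⟨ sum-mono-≤ half ⟩
  sum (λ v → count (crossing G c v) + count (crossing G c v))
                                              ≡⟨ ∑-distrib-+ (count ∘ crossing G c) _ ⟩
  sum (count ∘ crossing G c) + sum (count ∘ crossing G c)
                                              ≡⟨ cong (λ d → d + d) (degreeSum≡sum-count B) ⟨
  d + d                                       ≡⟨ cong (d +_) (+-identityʳ d) ⟨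
  2 * d                                       ∎)
  where
  open ≤-Reasoning
  B = crossingGraph G c
  d = degreeSum B

remove-arith : ∀ K s D d c → K * suc s < D + (d + d) + c → d + d ≤ K → K * s < D + c
remove-arith K s D d c lt d+d≤K = +-cancelˡ-< K (K * s) (D + c) (begin-strict
  K + K * s         ≡⟨ *-suc K s ⟨
  K * suc s         <⟨ lt ⟩
  D + (d + d) + c   ≤⟨ +-monoˡ-≤ c (+-monoʳ-≤ D d+d≤K) ⟩
  D + K + c         ≡⟨ xy∙z≈y∙xz D K c ⟩
  K + (D + c)       ∎)
  where open ≤-Reasoning

-- For s = 2k − 1 one has 4ks + s ≥ s² + 4k², so the two hypotheses clash.
size-arith : ∀ k s D → suc s ≡ k + k → 4 * k * s < D + 4 * k * k → D + s ≤ s * s → ⊥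
size-arith (suc j) s D eq lt le with suc-injective eq
... | refl = m+n≮m (s * s + 4 * k * k) (j + j) (begin-strict
  s * s + 4 * k * k + (j + j)   ≡⟨ identity j ⟨
  4 * k * s + s                 <⟨ +-monoˡ-< s lt ⟩
  D + 4 * k * k + s             ≡⟨ xy∙z≈xz∙y D (4 * k * k) s ⟩
  D + s + 4 * k * k             ≤⟨ +-monoˡ-≤ (4 * k * k) le ⟩
  s * s + 4 * k * k             ∎)
  where
  open ≤-Reasoning
  k = suc j
  identity : ∀ j → 4 * suc j * (j + suc j) + (j + suc j) ≡
                   (j + suc j) * (j + suc j) + 4 * suc j * suc j + (j + j)
  identity = solve-∀

separation-arith : ∀ K k s a b x DS DA DB → K * s < DS + K * k →
  DA + K * k ≤ K * a → DB + K * k ≤ K * b → DS ≤ DA + DB → a + b ≡ s + x → x < k → ⊥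
separation-arith K k s a b x DS DA DB lt la lb split ab x<k =
  m+n≮m (DS + K * k + K * k) K (begin-strict
  DS + K * k + K * k + K         ≤⟨ +-monoˡ-≤ K (+-monoˡ-≤ (K * k) (+-monoˡ-≤ (K * k) split)) ⟩
  DA + DB + K * k + K * k + K    ≡⟨ cong (_+ K) (regroup DA DB (K * k)) ⟩
  DA + K * k + (DB + K * k) + K  ≤⟨ +-monoˡ-≤ K (+-mono-≤ la lb) ⟩
  K * a + K * b + K              ≡⟨ cong (_+ K) (*-distribˡ-+ K a b) ⟨
  K * (a + b) + K                ≡⟨ cong (λ m → K * m + K) ab ⟩
  K * (s + x) + K                ≡⟨ expand K s x ⟩
  K * s + K * suc x              ≤⟨ +-monoʳ-≤ (K * s) (*-monoʳ-≤ K x<k) ⟩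
  K * s + K * k                  <⟨ +-monoˡ-< (K * k) lt ⟩
  DS + K * k + K * k             ∎)
  where
  open ≤-Reasoning
  regroup : ∀ a b c → a + b + c + c ≡ a + c + (b + c)
  regroup = solve-∀
  expand : ∀ K s x → K * (s + x) + K ≡ K * s + K * suc x
  expand = solve-∀

module Mader (G : Graph) {k : ℕ} (k>0 : 0 < k) where

  VertexSet : Set
  VertexSet = Fin (n G) → Bool

  deg : VertexSet → Fin (n G) → ℕ
  deg S v = count (λ w → adj G v w ∧ S w)

  inside : VertexSet → Fin (n G) → Fin (n G) → Bool
  inside S a b = S a ∧ (adj G a b ∧ S b)

  edgeIn : VertexSet → Fin (n G) → Fin (n G) → ℕ
  edgeIn S a b = ⟦ inside S a b ⟧

  degSum : VertexSet → ℕ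
  degSum S = sum² (edgeIn S)

  -- |S| ≥ 2k − 1 and e(G[S]) > 2k(|S| − k), where degSum S = 2 e(G[S]) and the
  -- inequality is rearranged to avoid truncated subtraction.
  Dense : VertexSet → Set
  Dense S = (k + k ≤ suc (count S)) × (4 * k * count S < degSum S + 4 * k * k)

  inside-sym : ∀ S a b → inside S a b ≡ inside S b a
  inside-sym S a b rewrite Graph.sym G a b with S a | S b
  ... | true | true = refl
  ... | true | false = ∧-zeroʳ _
  ... | false | true = sym (∧-zeroʳ _)
  ... | false | false = refl

  edgeIn-loop : ∀ S a → edgeIn S a a ≡ 0
  edgeIn-loop S a rewrite irrefl G a = cong ⟦_⟧ (∧-zeroʳ (S a))

  sum-edgeIn : ∀ S a → sum (edgeIn S a) ≡ ⟦ S a ⟧ * deg S a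
  sum-edgeIn S a with S a
  ... | true = sym (+-identityʳ _)
  ... | false = sum-replicate-zero (n G)

  suc-deg≤count : ∀ {S v} → S v ≡ true → suc (deg S v) ≤ count S
  suc-deg≤count {S} {v} Sv =
    count-mono-< (λ w → proj₂ ∘ ∧-true⇒ (adj G v w)) v (cong (_∧ S v) (irrefl G v)) Sv

  degSum+count≤count² : ∀ S → degSum S + count S ≤ count S * count S
  degSum+count≤count² S = begin
    degSum S + count S                     ≡⟨ ∑-distrib-+ (sum ∘ edgeIn S) (⟦_⟧ ∘ S) ⟨
    sum (λ a → sum (edgeIn S a) + ⟦ S a ⟧)  ≤⟨ sum-mono-≤ row≤ ⟩
    sum (λ a → count S * ⟦ S a ⟧)           ≡⟨ *-distribˡ-sum (count S) (⟦_⟧ ∘ S) ⟨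
    count S * count S                      ∎
    where
    open ≤-Reasoning
    row≤ : ∀ a → sum (edgeIn S a) + ⟦ S a ⟧ ≤ count S * ⟦ S a ⟧
    row≤ a rewrite sum-edgeIn S a with S a in Sa
    ... | true = subst₂ _≤_ (cong (_+ 1) (sym (+-identityʳ _))) (sym (*-identityʳ _))
                            (subst (_≤ count S) (+-comm 1 _) (suc-deg≤count Sa))
    ... | false = z≤n

  degSum-─ : ∀ {S v} → S v ≡ true → degSum (S ─ v) + (deg S v + deg S v) ≡ degSum S
  degSum-─ {S} {v} Sv = begin
    degSum (S ─ v) + (deg S v + deg S v)
      ≡⟨ cong (λ d → degSum (S ─ v) + (d + d)) row-v ⟨
    degSum (S ─ v) + (sum (edgeIn S v) + sum (edgeIn S v))
      ≡⟨ sum²-update v (λ a b → cong ⟦_⟧ (inside-sym S a b))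
                       (λ a b → cong ⟦_⟧ (inside-sym (S ─ v) a b))
                       unchanged (trans (edgeIn-loop S v) (sym (edgeIn-loop (S ─ v) v))) ⟩
    degSum S + (sum (edgeIn (S ─ v) v) + sum (edgeIn (S ─ v) v))
      ≡⟨ cong (λ d → degSum S + (d + d)) row-v-removed ⟩
    degSum S + 0
      ≡⟨ +-identityʳ _ ⟩
    degSum S ∎
    where
    open ≡-Reasoning
    row-v : sum (edgeIn S v) ≡ deg S v
    row-v = trans (sum-edgeIn S v) (trans (cong (λ x → ⟦ x ⟧ * deg S v) Sv) (+-identityʳ _))
    row-v-removed : sum (edgeIn (S ─ v) v) ≡ 0
    row-v-removed rewrite sum-edgeIn (S ─ v) v | ==-refl v | ∧-zeroʳ (S v) = refl
    unchanged : ∀ a b → a ≢ v → b ≢ v → edgeIn S a b ≡ edgeIn (S ─ v) a b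
    unchanged a b a≢v b≢v
      rewrite ==-≢ a≢v | ==-≢ b≢v | ∧-identityʳ (S a) | ∧-identityʳ (S b) = refl

  deg-mono : ∀ {S T} x → (∀ w → adj G x w ≡ true → S w ≡ true → T w ≡ true) →
    deg S x ≤ deg T x
  deg-mono x S⊆T = count-mono λ w e →
    let Exw , Sw = ∧-true⇒ (adj G x w) e in true∧true Exw (S⊆T w Exw Sw)

  dense⇒large : ∀ {S} → Dense S → k + k ≤ count S
  dense⇒large {S} (large , many) with m≤n⇒m<n∨m≡n large
  ... | inj₁ 2k<1+s = s≤s⁻¹ 2k<1+s
  ... | inj₂ 2k≡1+s =
    ⊥-elim (size-arith k (count S) (degSum S) (sym 2k≡1+s) many (degSum+count≤count² S))

  dense-─ : ∀ {S v} → S v ≡ true → deg S v ≤ k + k → Dense S → Dense (S ─ v)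
  dense-─ {S} {v} Sv low dense@(_ , many) =
    subst (k + k ≤_) count-S (dense⇒large dense) ,
    remove-arith (4 * k) (count (S ─ v)) (degSum (S ─ v)) (deg S v) (4 * k * k)
      (subst₂ (λ s D → 4 * k * s < D + 4 * k * k) count-S (sym (degSum-─ Sv)) many)
      (subst (deg S v + deg S v ≤_) (double-double k) (+-mono-≤ low low))
    where
    count-S : count S ≡ suc (count (S ─ v))
    count-S = count-─ {S = S} Sv
    double-double : ∀ k → k + k + (k + k) ≡ 4 * k
    double-double = solve-∀

  inside⇒ : ∀ S a b → inside S a b ≡ true → S a ≡ true × adj G a b ≡ true × S b ≡ true
  inside⇒ S a b e with ∧-true⇒ (S a) e
  ... | Sa , e′ with ∧-true⇒ (adj G a b) e′
  ... | Eab , Sb = Sa , Eab , Sb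

  ⇒inside : ∀ S {a b} → S a ≡ true → adj G a b ≡ true → S b ≡ true → inside S a b ≡ true
  ⇒inside S Sa Eab Sb = true∧true Sa (true∧true Eab Sb)

  induced : VertexSet → Subgraph G
  induced S = record
    { verts      = tabulate S
    ; edges      = inside S
    ; edges-sym  = inside-sym S
    ; edges-adj  = λ a b e → let _ , Eab , _ = inside⇒ S a b e in Eab
    ; edges-vert = λ a b e → let Sa , _ , Sb = inside⇒ S a b e in ∈tabulate Sa , ∈tabulate Sb
    }

  module _ (S : VertexSet) (X : Subset (n G)) where

    avail : VertexSet
    avail w = S w ∧ not (lookup X w)

    avail⇒ : ∀ {w} → avail w ≡ true → S w ≡ true × lookup X w ≡ false
    avail⇒ {w} e = let Sw , w∉X = ∧-true⇒ (S w) e in Sw , not-true⇒ w∉X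

    avail⇒Remaining : ∀ {w} → avail w ≡ true → Remaining (induced S) X w
    avail⇒Remaining e = let Sw , w∉X = avail⇒ e in
      ∈tabulate Sw , λ w∈X → true≢false (trans (sym ([]=⇒lookup w∈X)) w∉X)

    Remaining⇒avail : ∀ {w} → Remaining (induced S) X w → avail w ≡ true
    Remaining⇒avail {w} (w∈S , w∉X) = true∧true (∈tabulate⁻ w∈S) (cong not X-false)
      where
      X-false : lookup X w ≡ false
      X-false with lookup X w in Xw
      ... | true = ⊥-elim (w∉X (lookup⇒[]= w X Xw))
      ... | false = refl

    WalkAvoiding : Fin (n G) → Fin (n G) → Set
    WalkAvoiding = Walk (induced S) (Remaining (induced S) X)

    record Reachable (v : Fin (n G)) : Set where
      field
        members       : VertexSet
        members-avail : ∀ {w} → members w ≡ true → avail w ≡ true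
        members-walk  : ∀ {w} → members w ≡ true → WalkAvoiding w v
        root-member   : avail v ≡ true → members v ≡ true
    open Reachable public

    Closed : VertexSet → Set
    Closed R = ∀ {a b} → R a ≡ true → avail b ≡ true → adj G a b ≡ true → R b ≡ true

    singleton : ∀ v → Reachable v
    singleton v = record
      { members       = λ w → (w == v) ∧ avail v
      ; members-avail = λ {w} → proj₂ ∘ at-v {w}
      ; members-walk  = λ {w} e → case at-v {w} e of λ { (refl , Av) → nil (avail⇒Remaining Av) }
      ; root-member   = trans (cong (_∧ avail v) (==-refl v))
      }
      where
      at-v : ∀ {w} → (w == v) ∧ avail v ≡ true → w ≡ v × avail w ≡ true
      at-v {w} e with ∧-true⇒ (w == v) e
      ... | w==v , Av with ==⇒≡ {i = w} w==v
      ...   | refl = refl , Av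

    extend : ∀ {v} (R : Reachable v) {a b} →
      members R a ≡ true → avail b ≡ true → adj G a b ≡ true → Reachable v
    extend {v} R {a} {b} Ra Ab Eab = record
      { members       = insert b (members R)
      ; members-avail = λ {w} → by-cases {P = λ w → avail w ≡ true} (members-avail R) Ab
      ; members-walk  = λ {w} → by-cases {P = λ w → WalkAvoiding w v} (members-walk R) walk-b
      ; root-member   = λ Av → cong (_∨ (v == b)) (root-member R Av)
      }
      where
      by-cases : ∀ {P : Fin (n G) → Set} {w} →
        (members R w ≡ true → P w) → P b → insert b (members R) w ≡ true → P w
      by-cases {P} {w} inR atB e with members R w
      ... | true = inR refl
      ... | false = subst P (sym (==⇒≡ e)) atB
      walk-b : WalkAvoiding b v
      walk-b = cons (avail⇒Remaining Ab)
                    (⇒inside S (proj₁ (avail⇒ Ab)) (trans (Graph.sym G b a) Eab)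
                             (proj₁ (avail⇒ (members-avail R Ra))))
                    (members-walk R Ra)

    frontier : VertexSet → Fin (n G) → Fin (n G) → Bool
    frontier R a b = R a ∧ (avail b ∧ (adj G a b ∧ not (R b)))

    frontier⇒ : ∀ R a b → frontier R a b ≡ true →
      R a ≡ true × avail b ≡ true × adj G a b ≡ true × R b ≡ false
    frontier⇒ R a b e with ∧-true⇒ (R a) e
    ... | Ra , e₁ with ∧-true⇒ (avail b) e₁
    ... | Ab , e₂ with ∧-true⇒ (adj G a b) e₂
    ... | Eab , ¬Rb = Ra , Ab , Eab , not-true⇒ ¬Rb

    grow : ∀ {v} (R : Reachable v) → Acc _<_ (n G ∸ count (members R)) →
      Σ[ C ∈ Reachable v ] Closed (members C)
    grow R (acc rs) with any? (λ a → any? (λ b → frontier (members R) a b ≟ᵇ true))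
    ... | yes (a , b , e) =
      let Ra , Ab , Eab , Rb = frontier⇒ (members R) a b e
          larger = ≤-reflexive (sym (count-insert {S = members R} Rb))
      in grow (extend R Ra Ab Eab) (rs (∸-monoʳ-< larger (count≤n _)))
    ... | no noFrontier = R , closed
      where
      closed : Closed (members R)
      closed {a} {b} Ra Ab Eab with members R b in Rb
      ... | true = refl
      ... | false =
        ⊥-elim (noFrontier (a , b , true∧true Ra (true∧true Ab (true∧true Eab (cong not Rb)))))

    component : ∀ v → Σ[ C ∈ Reachable v ] Closed (members C)
    component v = grow (singleton v) (<-wellFounded _)

    module Separation {u v} (C : Reachable v) (closed : Closed (members C))
      (Au : avail u ≡ true) (Av : avail v ≡ true) (u∉C : members C u ≡ false)
      (high : ∀ {w} → S w ≡ true → k + k < deg S w) where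

      A B S∩X : VertexSet
      A w = members C w ∨ (S w ∧ lookup X w)
      B w = S w ∧ not (members C w)
      S∩X w = S w ∧ lookup X w

      C⊆S : ∀ {w} → members C w ≡ true → S w ≡ true
      C⊆S = proj₁ ∘ avail⇒ ∘ members-avail C

      v∈C : members C v ≡ true
      v∈C = root-member C Av

      Su : S u ≡ true
      Su = proj₁ (avail⇒ Au)

      A⊆S : ∀ w → A w ≡ true → S w ≡ true
      A⊆S w e with members C w in Cw
      ... | true = C⊆S Cw
      ... | false = proj₁ (∧-true⇒ (S w) e)

      B⊆S : ∀ w → B w ≡ true → S w ≡ true
      B⊆S w = proj₁ ∘ ∧-true⇒ (S w)

      count-A<count-S : count A < count S
      count-A<count-S = count-mono-< A⊆S u u∉A Su
        where
        u∉A : A u ≡ false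
        u∉A rewrite u∉C | proj₂ (avail⇒ Au) = ∧-zeroʳ (S u)

      count-B<count-S : count B < count S
      count-B<count-S = count-mono-< B⊆S v v∉B (C⊆S v∈C)
        where
        v∉B : B v ≡ false
        v∉B rewrite v∈C = ∧-zeroʳ (S v)

      -- C is closed, so b is not available.
      leaves-C-into-X : ∀ {a b} → members C a ≡ true → S b ≡ true → adj G a b ≡ true →
        members C b ≡ false → lookup X b ≡ true
      leaves-C-into-X {a} {b} Ca Sb Eab Cb with lookup X b in Xb
      ... | true = refl
      ... | false = ⊥-elim (true≢false (trans (sym (closed Ca (true∧true Sb (cong not Xb)) Eab)) Cb))

      large-A : k + k ≤ suc (count A)
      large-A = m<n⇒m≤1+n (<-≤-trans (high (C⊆S v∈C))
                                     (≤-trans (deg-mono v neighbour-in-A) (<⇒≤ (suc-deg≤count A-v))))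
        where
        A-v : A v ≡ true
        A-v rewrite v∈C = refl
        neighbour-in-A : ∀ w → adj G v w ≡ true → S w ≡ true → A w ≡ true
        neighbour-in-A w Evw Sw with members C w in Cw
        ... | true = refl
        ... | false rewrite Sw = leaves-C-into-X v∈C Sw Evw Cw

      large-B : k + k ≤ suc (count B)
      large-B = m<n⇒m≤1+n (<-≤-trans (high Su)
                                     (≤-trans (deg-mono u neighbour-in-B) (<⇒≤ (suc-deg≤count B-u))))
        where
        B-u : B u ≡ true
        B-u rewrite u∉C = trans (∧-identityʳ (S u)) Su
        neighbour-in-B : ∀ w → adj G u w ≡ true → S w ≡ true → B w ≡ true
        neighbour-in-B w Euw Sw with members C w in Cw
        ... | true = ⊥-elim (true≢false (trans (sym (closed Cw Au (trans (Graph.sym G w u) Euw))) u∉C))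
        ... | false = trans (∧-identityʳ (S w)) Sw

      edge-split : ∀ a b → inside S a b ≡ true → inside A a b ≡ true ⊎ inside B a b ≡ true
      edge-split a b e with inside⇒ S a b e | members C a in Ca | members C b in Cb
      ... | _ , Eab , _ | true | true = inj₁ (true∧true Eab refl)
      ... | _ , Eab , Sb | true | false =
        inj₁ (true∧true Eab (true∧true Sb (leaves-C-into-X Ca Sb Eab Cb)))
      ... | Sa , Eab , _ | false | true =
        inj₁ (true∧true (true∧true Sa (leaves-C-into-X Cb Sa (trans (Graph.sym G b a) Eab) Ca))
                        (true∧true Eab refl))
      ... | Sa , Eab , Sb | false | false =
        inj₂ (true∧true (true∧true Sa refl) (true∧true Eab (true∧true Sb refl)))

      degSum-split : degSum S ≤ degSum A + degSum B
      degSum-split = subst (degSum S ≤_) (sum²-distrib-+ (edgeIn A) (edgeIn B))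
        (sum-mono-≤ (λ a → sum-mono-≤ (λ b → ⟦⟧≤⟦⟧+⟦⟧ (edge-split a b))))

      count-split : count A + count B ≡ count S + count S∩X
      count-split = trans (sym (∑-distrib-+ (⟦_⟧ ∘ A) (⟦_⟧ ∘ B)))
                          (trans (sum-cong-≗ pointwise) (∑-distrib-+ (⟦_⟧ ∘ S) (⟦_⟧ ∘ S∩X)))
        where
        pointwise : ∀ w → ⟦ A w ⟧ + ⟦ B w ⟧ ≡ ⟦ S w ⟧ + ⟦ S∩X w ⟧
        pointwise w with members C w in Cw
        ... | true rewrite C⊆S Cw | proj₂ (avail⇒ (members-avail C Cw)) = refl
        ... | false = trans (cong (λ x → ⟦ S∩X w ⟧ + ⟦ x ⟧) (∧-identityʳ (S w)))
                            (+-comm ⟦ S∩X w ⟧ ⟦ S w ⟧)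

      count-S∩X≤∣X∣ : count S∩X ≤ ∣ X ∣
      count-S∩X≤∣X∣ =
        subst (count S∩X ≤_) (sym (∣∣≡count X)) (count-mono (λ w → proj₂ ∘ ∧-true⇒ (S w)))

      denser-part : Dense S → ∣ X ∣ < k → Σ[ T ∈ VertexSet ] count T < count S × Dense T
      denser-part (_ , manyS) X<k
        with 4 * k * count A <? degSum A + 4 * k * k | 4 * k * count B <? degSum B + 4 * k * k
      ... | yes manyA | _ = A , count-A<count-S , large-A , manyA
      ... | no _ | yes manyB = B , count-B<count-S , large-B , manyB
      ... | no fewA | no fewB =
        ⊥-elim (separation-arith (4 * k) k (count S) (count A) (count B) (count S∩X)
                                 (degSum S) (degSum A) (degSum B) manyS (≮⇒≥ fewA) (≮⇒≥ fewB)
                                 degSum-split count-split (≤-<-trans count-S∩X≤∣X∣ X<k))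

  inComponent : VertexSet → Subset (n G) → Fin (n G) → VertexSet
  inComponent S X v = members (proj₁ (component S X v))

  Separates : VertexSet → Subset (n G) → Fin (n G) → Fin (n G) → Set
  Separates S X u v =
    ∣ X ∣ < k × avail S X u ≡ true × avail S X v ≡ true × inComponent S X v u ≡ false

  separates? : ∀ S X u v → Dec (Separates S X u v)
  separates? S X u v = ∣ X ∣ <? k ×-dec avail S X u ≟ᵇ true ×-dec avail S X v ≟ᵇ true
                       ×-dec inComponent S X v u ≟ᵇ false

  LowDegree : VertexSet → Fin (n G) → Set
  LowDegree S v = S v ≡ true × deg S v ≤ k + k

  HighDegree : VertexSet → Set
  HighDegree S = ∀ {w} → S w ≡ true → k + k < deg S w

  no-low⇒high : ∀ {S} → ¬ (Σ[ v ∈ Fin (n G) ] LowDegree S v) → HighDegree S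
  no-low⇒high noLow {w} Sw = ≰⇒> (λ low → noLow (w , Sw , low))

  induced-KConnected : ∀ S → HighDegree S → Dense S → (∀ X u v → ¬ Separates S X u v) →
    KConnected k (induced S)
  induced-KConnected S high dense unseparated = size , connected
    where
    size : suc k ≤ ∣ tabulate S ∣
    size with count>0⇒∃ {p = S} (<-≤-trans k>0 (≤-trans (m≤m+n k k) (dense⇒large dense)))
    ... | w , Sw = subst (suc k ≤_) (sym (∣tabulate∣≡count S))
                     (≤-trans (subst (_≤ k + k) (+-comm k 1) (+-monoʳ-≤ k k>0))
                              (<⇒≤ (<-trans (high Sw) (suc-deg≤count Sw))))
    connected : ∀ X → ∣ X ∣ < k → ConnectedAfterRemoving (induced S) X
    connected X X<k u v Ru Rv with inComponent S X v u in u∈C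
    ... | true = members-walk (proj₁ (component S X v)) u∈C
    ... | false =
      ⊥-elim (unseparated X u v (X<k , Remaining⇒avail S X Ru , Remaining⇒avail S X Rv , u∈C))

  KConnectedSubgraph : Set
  KConnectedSubgraph = Σ[ H ∈ Subgraph G ] KConnected k H

  minimalDense : ∀ S → Acc _<_ (count S) → Dense S → KConnectedSubgraph
  minimalDense S (acc rs) dense with any? (λ v → S v ≟ᵇ true ×-dec deg S v ≤? k + k)
  ... | yes (v , Sv , low) =
    minimalDense (S ─ v) (rs (≤-reflexive (sym (count-─ {S = S} Sv)))) (dense-─ Sv low dense)
  ... | no noLow with anySubset? (λ X → any? (λ u → any? (λ v → separates? S X u v)))
  ...   | no unseparated =
    induced S ,
    induced-KConnected S (no-low⇒high noLow) dense (λ X u v sep → unseparated (X , u , v , sep))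
  ...   | yes (X , u , v , X<k , Au , Av , u∉C) =
    let C , closed = component S X v
        T , T<S , denseT = Separation.denser-part S X C closed Au Av u∉C (no-low⇒high noLow) dense X<k
    in minimalDense T (rs T<S) denseT

  avgDegree⇒large : ∀ S → 0 < count S → 4 * k * count S ≤ degSum S → suc (4 * k) ≤ count S
  avgDegree⇒large S s>0 avg =
    *-cancelʳ-≤ (suc (4 * k)) (count S) (count S) {{>-nonZero s>0}} (begin
    suc (4 * k) * count S      ≡⟨ +-comm (count S) (4 * k * count S) ⟩
    4 * k * count S + count S  ≤⟨ +-monoˡ-≤ (count S) avg ⟩
    degSum S + count S         ≤⟨ degSum+count≤count² S ⟩
    count S * count S          ∎)
    where open ≤-Reasoning

  whole : VertexSet
  whole _ = true

  count-whole : count whole ≡ n G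
  count-whole = sum-const-1 (n G)

  degSum-whole : degSum whole ≡ degreeSum G
  degSum-whole =
    trans (sum-cong-≗ (λ a → sum-cong-≗ (λ b → cong ⟦_⟧ (∧-identityʳ (adj G a b)))))
          (sym (degreeSum≡sum-count G))

  dense-whole : 0 < n G → AvgDegreeAtLeast G (4 * k) → Dense whole
  dense-whole N>0 avg = large , ≤-<-trans avg′ (m<m+n (degSum whole) 4k²>0)
    where
    avg′ : 4 * k * count whole ≤ degSum whole
    avg′ = subst₂ (λ s D → 4 * k * s ≤ D) (sym count-whole) (sym degSum-whole) avg
    large : k + k ≤ suc (count whole)
    large = ≤-trans (+-monoʳ-≤ k (m≤m+n k (k + (k + 0))))
              (m≤n⇒m≤1+n (<⇒≤ (avgDegree⇒large whole (subst (0 <_) (sym count-whole) N>0) avg′)))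
    4k²>0 : 0 < 4 * k * k
    4k²>0 = *-mono-≤ (≤-trans k>0 (m≤m+n k (3 * k))) k>0

mader : (k : ℕ) → 0 < k → (G : Graph) → 0 < n G → AvgDegreeAtLeast G (4 * k) →
  Σ[ H ∈ Subgraph G ] KConnected k H
mader k k>0 G N>0 avg = minimalDense whole (<-wellFounded _) (dense-whole N>0 avg)
  where open Mader G k>0

module _ (G : Graph) (c : Colouring G) where

  liftSubgraph : Subgraph (crossingGraph G c) → Subgraph G
  liftSubgraph H = record
    { verts      = verts H
    ; edges      = edges H
    ; edges-sym  = edges-sym H
    ; edges-adj  = λ i j e → proj₁ (∧-true⇒ (adj G i j) (edges-adj H i j e))
    ; edges-vert = edges-vert H
    }

  liftWalk : ∀ {H P u v} → Walk H P u v → Walk (liftSubgraph H) P u v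
  liftWalk (nil Pu) = nil Pu
  liftWalk (cons Pu e walk) = cons Pu e (liftWalk walk)

  liftSubgraph-KConnected : ∀ {ℓ H} → KConnected ℓ H → KConnected ℓ (liftSubgraph H)
  liftSubgraph-KConnected (large , connected) =
    large , λ X X<ℓ u v Ru Rv → liftWalk (connected X X<ℓ u v Ru Rv)

  liftSubgraph-Bipartite : ∀ H → Bipartite (liftSubgraph H)
  liftSubgraph-Bipartite H = c , λ i j e ci≡cj →
    true≢false (trans (sym (proj₂ (∧-true⇒ (adj G i j) (edges-adj H i j e))))
                      (trans (cong (_xor c j) ci≡cj) (xor-same (c j))))

halve-≤ : ∀ ℓ N d d′ → 8 * ℓ * N ≤ d → d ≤ 2 * d′ → 4 * ℓ * N ≤ d′
halve-≤ ℓ N d d′ lo hi = *-cancelˡ-≤ 2 (subst (_≤ 2 * d′) (regroup ℓ N) (≤-trans lo hi))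
  where
  regroup : ∀ ℓ N → 8 * ℓ * N ≡ 2 * (4 * ℓ * N)
  regroup = solve-∀

corollary4 : (ℓ : ℕ) → 0 < ℓ → (G : Graph) → 0 < n G → AvgDegreeAtLeast G (8 * ℓ) →
    Σ[ H ∈ Subgraph G ] (Bipartite H × KConnected ℓ H)
corollary4 ℓ ℓ>0 G N>0 avg =
  let c , half = halvingCrossingGraph G
      B = crossingGraph G c
      H , ℓ-connected = mader ℓ ℓ>0 B N>0 (halve-≤ ℓ (n G) (degreeSum G) (degreeSum B) avg half)
  in liftSubgraph G c H , liftSubgraph-Bipartite G c H , liftSubgraph-KConnected G c ℓ-connected
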